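{- Let $G_B$ be a boundaried graph, $T_G\subseteq V(G)$, and $\ell\ge0$ such that $(G,T_G)$ has a Deletable Terminal Multiway Cut solution $S$ with $|S|\le\ell$. Suppose that (i) no connected component $C$ of $G$ satisfies $|C\cap T_G|\le1$ and $C\cap B=\emptyset$, and (ii) there is no vertex $v\in V(G)$ for which there exist $\ell+|B|+2$ paths in $G$ starting at $v$, ending at pairwise distinct vertices of $T_G$, and pairwise intersecting only in $v$. Then $|T_G|=\mathcal O((|B|+\ell)^2)$.
   Context: All graphs are finite, simple, undirected; $B\subseteq V(G)$. Deletable Terminal Multiway Cut: given a graph $G$ and $T\subseteq V(G)$, a feasible solution is any $Y\subseteq V(G)$ such that $G-Y$ has no path between two distinct vertices of $T\setminus Y$; its value is $|Y|$. -}

module Defs where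

open import Data.Nat using (ℕ; _+_; _*_; _^_; _≤_)
open import Data.Fin using (Fin)
open import Data.Fin.Subset using (Subset; _∈_; _∉_; ∣_∣)
open import Data.Bool using (Bool; true)
open import Data.List using (List; []; _∷_)
open import Data.List.Membership.Propositional using () renaming (_∈_ to _∈ˡ_)
open import Data.List.Relation.Unary.All using (All)
open import Data.List.Relation.Unary.Unique.Propositional using (Unique)
open import Data.Product using (Σ; ∃; _×_; _,_; proj₁)
open import Relation.Binary.PropositionalEquality using (_≡_; _≢_)
open import Relation.Nullary using (¬_)

record Graph (n : ℕ) : Set where
  field
    adj   : Fin n → Fin n → Bool
    sym   : ∀ u v → adj u v ≡ adj v u
    irefl : ∀ v → ¬ (adj v v ≡ true)

open Graph public

data Walk {n : ℕ} (G : Graph n) : Fin n → Fin n → Set where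
  here : ∀ {u} → Walk G u u
  step : ∀ {u v w} → adj G u v ≡ true → Walk G v w → Walk G u w

verts : ∀ {n} {G : Graph n} {u w} → Walk G u w → List (Fin n)
verts {u = u} here = u ∷ []
verts {u = u} (step _ p) = u ∷ verts p

Path : ∀ {n} → Graph n → Fin n → Fin n → Set
Path G u w = Σ (Walk G u w) (λ p → Unique (verts p))

ConnectedAvoiding : ∀ {n} → Graph n → Subset n → Fin n → Fin n → Set
ConnectedAvoiding G Y u w = Σ (Walk G u w) (λ p → All (λ x → x ∉ Y) (verts p))

Reachable : ∀ {n} → Graph n → Fin n → Fin n → Set
Reachable G u w = Walk G u w

DTMCSolution : ∀ {n} → Graph n → Subset n → Subset n → Set
DTMCSolution G T Y =
  ∀ t₁ t₂ → t₁ ∈ T → t₂ ∈ T → t₁ ∉ Y → t₂ ∉ Y → t₁ ≢ t₂ →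
  ¬ ConnectedAvoiding G Y t₁ t₂

-- Condition (i) violated: some connected component C (the component of x)
-- with |C ∩ T| ≤ 1 and C ∩ B = ∅.
BadComponent : ∀ {n} → Graph n → Subset n → Subset n → Set
BadComponent G B T =
  Σ (Fin _) λ x →
    (∀ y → Reachable G x y → y ∉ B) ×
    (∀ t₁ t₂ → Reachable G x t₁ → Reachable G x t₂ → t₁ ∈ T → t₂ ∈ T → t₁ ≡ t₂)

Flower : ∀ {n} → Graph n → Subset n → Fin n → ℕ → Set
Flower {n} G T v k =
  Σ (Fin k → Fin n) λ end →
  Σ ((i : Fin k) → Path G v (end i)) λ P →
    (∀ i → end i ∈ T) ×
    (∀ i j → end i ≡ end j → i ≡ j) ×
    (∀ i j → i ≢ j → ∀ x → x ∈ˡ verts (proj₁ (P i)) →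
                         x ∈ˡ verts (proj₁ (P j)) → x ≡ v)

-- Fix a solution S with |S| ≤ ℓ and charge every terminal t to an anchor: t itself
-- if t ∈ S; otherwise look at the component C of t in G - S.  If no vertex of S is
-- adjacent to C, then C is a whole component of G, and it holds at most one terminal
-- because S separates terminals; by (i) it meets B, and t is charged to such a
-- boundary vertex.  Otherwise t is charged to a vertex of S adjacent to C.
-- A boundary vertex outside S is charged at most once, since two terminals charged to
-- it would be connected in G - S.  The terminals charged to w ∈ S other than w lie in
-- pairwise distinct components of G - S adjacent to w, so paths into these components
-- form a flower at w, and by (ii) there are at most ℓ + |B| + 1 of them.  Hence
-- |T| ≤ (ℓ + |B| + 1)|S| + |B| ≤ 2(|B| + ℓ)².

module Submission where

open import Defs
open import Data.Nat using (ℕ; _+_; _*_; _^_; _≤_)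
open import Data.Fin using (Fin)
open import Data.Fin.Subset using (Subset; ∣_∣)
open import Data.Product using (Σ; ∃; _×_)
open import Relation.Nullary using (¬_)

open import Level using (0ℓ)
open import Data.Nat using (zero; suc; z≤n; s≤s)
open import Data.Nat.Properties
  using (+-*-semiring; ≤-trans; ≤-reflexive; +-mono-≤; +-monoˡ-≤; *-monoʳ-≤; module ≤-Reasoning; m≤m+n; m≤n+m; m≤m*n; +-suc; ≰⇒>; _≤?_; *-identityʳ)
open import Data.Nat.Solver using (module +-*-Solver)
open import Data.Fin using (zero; suc; _≟_)
open import Data.Fin.Properties using (suc-injective; 0≢1+n)
open import Data.Fin.Subset using (_∈_; _∉_; inside; outside)
open import Data.Fin.Subset.Properties using (_∈?_)
open import Data.Bool using (true; if_then_else_)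
open import Data.Vec using ([]; _∷_)
open import Data.List.Membership.Propositional using () renaming (_∈_ to _∈ˡ_)
open import Data.List.Relation.Binary.Subset.Propositional using (_⊆_)
open import Data.List.Relation.Unary.All as All using (All; []; _∷_)
open import Data.List.Relation.Unary.All.Properties using (anti-mono)
open import Data.List.Relation.Unary.Any using (here; there; any?)
open import Data.List.Relation.Unary.Unique.Propositional using (Unique)
open import Data.List.Relation.Unary.AllPairs using ([]; _∷_)
open import Data.Product using (_,_; proj₁; proj₂)
open import Data.Sum using (_⊎_; inj₁; inj₂)
open import Data.Empty using (⊥-elim)
open import Function using (_∘_)
open import Relation.Nullary using (Dec; yes; no; does)
open import Relation.Nullary.Decidable using (_×-dec_; decidable-stable)
open import Relation.Unary using (Pred; Decidable)
open import Relation.Binary.PropositionalEquality as ≡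
  using (_≡_; _≢_; refl; trans; cong; cong₂; subst)
open import Algebra.Properties.Semiring.Sum +-*-semiring
  using (sum; sum-syntax; ∑-comm; ∑-distrib-+; *-distribˡ-sum)

indicator : ∀ {A : Set} → Dec A → ℕ
indicator d = if does d then 1 else 0

indicator-yes : ∀ {A : Set} → A → (d : Dec A) → indicator d ≡ 1
indicator-yes a (yes _) = refl
indicator-yes a (no ¬a) = ⊥-elim (¬a a)

indicator≤ : ∀ {A : Set} {m} (d : Dec A) → (A → 1 ≤ m) → indicator d ≤ m
indicator≤ (yes a) 1≤m = 1≤m a
indicator≤ (no _) _ = z≤n

count : ∀ {n} {P : Pred (Fin n) 0ℓ} → Decidable P → ℕ
count {n} P? = ∑[ i < n ] indicator (P? i)

∑-mono-≤ : ∀ {n} {f g : Fin n → ℕ} → (∀ i → f i ≤ g i) → sum f ≤ sum g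
∑-mono-≤ {zero} f≤g = z≤n
∑-mono-≤ {suc n} f≤g = +-mono-≤ (f≤g zero) (∑-mono-≤ (λ i → f≤g (suc i)))

f≤∑f : ∀ {n} (f : Fin n → ℕ) i → f i ≤ sum f
f≤∑f f zero = m≤m+n _ _
f≤∑f f (suc i) = ≤-trans (f≤∑f (λ j → f (suc j)) i) (m≤n+m _ _)

∣p∣≡count : ∀ {n} (p : Subset n) → ∣ p ∣ ≡ count (_∈? p)
∣p∣≡count [] = refl
∣p∣≡count (inside ∷ p) = cong suc (∣p∣≡count p)
∣p∣≡count (outside ∷ p) = ∣p∣≡count p

injection-from-count : ∀ {n} {P : Pred (Fin n) 0ℓ} (P? : Decidable P) m → m ≤ count P? →
  Σ (Fin m → Fin n) λ e → (∀ i → P (e i)) × (∀ i j → e i ≡ e j → i ≡ j)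
injection-from-count {zero} P? zero _ = (λ ()) , (λ ()) , (λ ())
injection-from-count {suc n} P? m m≤ with P? zero
... | no _ with injection-from-count (λ i → P? (suc i)) m m≤
...   | e , Pe , e-inj = (λ i → suc (e i)) , Pe , λ i j eq → e-inj i j (suc-injective eq)
injection-from-count {suc n} P? zero _ | yes _ = (λ ()) , (λ ()) , (λ ())
injection-from-count {suc n} {P} P? (suc m) (s≤s m≤) | yes P0
  with injection-from-count (λ i → P? (suc i)) m m≤
... | e , Pe , e-inj = e′ , Pe′ , e′-inj
  where
  e′ : Fin (suc m) → Fin (suc n)
  e′ zero = zero
  e′ (suc i) = suc (e i)
  Pe′ : ∀ i → P (e′ i)
  Pe′ zero = P0
  Pe′ (suc i) = Pe i
  e′-inj : ∀ i j → e′ i ≡ e′ j → i ≡ j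
  e′-inj zero zero _ = refl
  e′-inj (suc i) (suc j) eq = cong suc (e-inj i j (suc-injective eq))
  e′-inj zero (suc j) ()
  e′-inj (suc i) zero ()

count≤-if-no-injection : ∀ {n} {P : Pred (Fin n) 0ℓ} (P? : Decidable P) k →
  (∀ (e : Fin (suc k) → Fin n) → (∀ i → P (e i)) → ¬ (∀ i j → e i ≡ e j → i ≡ j)) →
  count P? ≤ k
count≤-if-no-injection P? k noInj with count P? ≤? k
... | yes ≤k = ≤k
... | no ≰k with injection-from-count P? (suc k) (≰⇒> ≰k)
...   | e , Pe , e-inj = ⊥-elim (noInj e Pe e-inj)

count≤∑-fibres : ∀ {n m} {P : Pred (Fin n) 0ℓ} (P? : Decidable P) (f : Fin n → Fin m) →
  count P? ≤ ∑[ w < m ] count (λ t → P? t ×-dec (f t ≟ w))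
count≤∑-fibres {n} {m} P? f = ≤-trans (∑-mono-≤ in-own-fibre)
  (≤-reflexive (∑-comm (λ t w → indicator (P? t ×-dec (f t ≟ w)))))
  where
  in-own-fibre : ∀ t → indicator (P? t) ≤ ∑[ w < m ] indicator (P? t ×-dec (f t ≟ w))
  in-own-fibre t = indicator≤ (P? t) λ Pt →
    ≤-trans (≤-reflexive (≡.sym (indicator-yes (Pt , refl) (P? t ×-dec (f t ≟ f t)))))
            (f≤∑f (λ w → indicator (P? t ×-dec (f t ≟ w))) (f t))

¬¬-Π-Fin : ∀ {n} {A : Fin n → Set} → (∀ i → ¬ ¬ A i) → ¬ ¬ (∀ i → A i)
¬¬-Π-Fin {zero} _ k = k (λ ())
¬¬-Π-Fin {suc n} {A} ¬¬A k = ¬¬A zero λ a₀ → ¬¬-Π-Fin (λ i → ¬¬A (suc i)) λ as → k (cons a₀ as)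
  where
  cons : A zero → (∀ i → A (suc i)) → ∀ i → A i
  cons a₀ as zero = a₀
  cons a₀ as (suc i) = as i

module Walks {n} (G : Graph n) where

  adj-sym : ∀ {u v} → adj G u v ≡ true → adj G v u ≡ true
  adj-sym {u} {v} e = trans (≡.sym (Graph.sym G u v)) e

  _++ʷ_ : ∀ {u v w} → Walk G u v → Walk G v w → Walk G u w
  here ++ʷ q = q
  step e p ++ʷ q = step e (p ++ʷ q)

  reverse : ∀ {u w} → Walk G u w → Walk G w u
  reverse here = here
  reverse (step e p) = reverse p ++ʷ step (adj-sym e) here

  suffix : ∀ {v w x} (p : Walk G v w) → x ∈ˡ verts p → Walk G x w
  suffix here (here refl) = here
  suffix (step e p) (here refl) = step e p
  suffix (step e p) (there x∈p) = suffix p x∈p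

  suffix-⊆ : ∀ {v w x} (p : Walk G v w) (x∈p : x ∈ˡ verts p) → verts (suffix p x∈p) ⊆ verts p
  suffix-⊆ here (here refl) = λ y∈ → y∈
  suffix-⊆ (step e p) (here refl) = λ y∈ → y∈
  suffix-⊆ (step e p) (there x∈p) = λ y∈ → there (suffix-⊆ p x∈p y∈)

  suffix-unique : ∀ {v w x} (p : Walk G v w) (x∈p : x ∈ˡ verts p) →
    Unique (verts p) → Unique (verts (suffix p x∈p))
  suffix-unique here (here refl) u = u
  suffix-unique (step e p) (here refl) u = u
  suffix-unique (step e p) (there x∈p) (_ ∷ u) = suffix-unique p x∈p u

  -- Loop erasure: cut the walk back to the last visit of its first vertex.
  toPath : ∀ {u w} (p : Walk G u w) → Σ (Path G u w) λ q → verts (proj₁ q) ⊆ verts p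
  toPath here = (here , [] ∷ []) , λ x∈ → x∈
  toPath {u} (step e p) with toPath p
  ... | (q , q-unique) , q⊆p with any? (u ≟_) (verts q)
  ...   | yes u∈q = (suffix q u∈q , suffix-unique q u∈q q-unique) , λ x∈ → there (q⊆p (suffix-⊆ q u∈q x∈))
  ...   | no u∉q = (step e q , All.tabulate (λ x∈q u≡x → u∉q (subst (_∈ˡ verts q) (≡.sym u≡x) x∈q)) ∷ q-unique)
                 , λ { (here x≡u) → here x≡u ; (there x∈q) → there (q⊆p x∈q) }

  module _ {P : Fin n → Set} where

    All-++ʷ : ∀ {u v w} (p : Walk G u v) (q : Walk G v w) →
      All P (verts p) → All P (verts q) → All P (verts (p ++ʷ q))
    All-++ʷ here q _ Pq = Pq
    All-++ʷ (step e p) q (Pu ∷ Pp) Pq = Pu ∷ All-++ʷ p q Pp Pq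

    All-source : ∀ {u w} (p : Walk G u w) → All P (verts p) → P u
    All-source here (Pu ∷ _) = Pu
    All-source (step _ _) (Pu ∷ _) = Pu

    All-target : ∀ {u w} (p : Walk G u w) → All P (verts p) → P w
    All-target here (Pw ∷ _) = Pw
    All-target (step _ p) (_ ∷ Pp) = All-target p Pp

    All-reverse : ∀ {u w} (p : Walk G u w) → All P (verts p) → All P (verts (reverse p))
    All-reverse here Pp = Pp
    All-reverse (step e p) (Pu ∷ Pp) = All-++ʷ (reverse p) _ (All-reverse p Pp) (All-source p Pp ∷ Pu ∷ [])

  module Avoiding (Y : Subset n) where

    _~_ : Fin n → Fin n → Set
    _~_ = ConnectedAvoiding G Y

    ~-trans : ∀ {a b c} → a ~ b → b ~ c → a ~ c
    ~-trans (p , p∉Y) (q , q∉Y) = p ++ʷ q , All-++ʷ p q p∉Y q∉Y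

    ~-sym : ∀ {a b} → a ~ b → b ~ a
    ~-sym (p , p∉Y) = reverse p , All-reverse p p∉Y

    ~-source∉ : ∀ {a b} → a ~ b → a ∉ Y
    ~-source∉ (p , p∉Y) = All-source p p∉Y

    ~-target∉ : ∀ {a b} → a ~ b → b ∉ Y
    ~-target∉ (p , p∉Y) = All-target p p∉Y

    ~-suffix : ∀ {a b x} (p : Walk G a b) → All (_∉ Y) (verts p) → x ∈ˡ verts p → x ~ b
    ~-suffix p p∉Y x∈p = suffix p x∈p , anti-mono (suffix-⊆ p x∈p) p∉Y

    closed-component : ∀ {t} → (∀ {x y} → t ~ x → adj G x y ≡ true → y ∉ Y) →
      ∀ {x y} → t ~ x → Walk G x y → t ~ y
    closed-component closed t~x here = t~x
    closed-component closed t~x (step e p) =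
      closed-component closed (~-trans t~x (step e here , ~-target∉ t~x ∷ closed t~x e ∷ [])) p

module _ {n} {G : Graph n} {B T S : Subset n} (sol : DTMCSolution G T S) where

  open Walks G
  open Avoiding S

  separated : ∀ {t₁ t₂} → t₁ ∈ T → t₂ ∈ T → t₁ ~ t₂ → t₁ ≡ t₂
  separated {t₁} {t₂} t₁∈T t₂∈T t₁~t₂ with t₁ ≟ t₂
  ... | yes eq = eq
  ... | no neq = ⊥-elim (sol t₁ t₂ t₁∈T t₂∈T (~-source∉ t₁~t₂) (~-target∉ t₁~t₂) neq t₁~t₂)

  data Anchor (t w : Fin n) : Set where
    deleted   : t ∈ S → t ≡ w → Anchor t w
    boundary  : w ∈ B → t ~ w → Anchor t w
    neighbour : ∀ {u} → w ∈ S → adj G w u ≡ true → u ~ t → Anchor t w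

  anchor-exists : ¬ BadComponent G B T → ∀ t → ¬ ¬ ∃ (Anchor t)
  anchor-exists noBad t noAnchor with t ∈? S
  ... | yes t∈S = noAnchor (t , deleted t∈S refl)
  ... | no t∉S = noBad (t , no-boundary , one-terminal)
    where
    inComponent : ∀ {y} → Walk G t y → t ~ y
    inComponent = closed-component
      (λ t~x e y∈S → noAnchor (_ , neighbour y∈S (adj-sym e) (~-sym t~x))) (here , t∉S ∷ [])
    no-boundary : ∀ y → Reachable G t y → y ∉ B
    no-boundary y p y∈B = noAnchor (y , boundary y∈B (inComponent p))
    one-terminal : ∀ t₁ t₂ → Reachable G t t₁ → Reachable G t t₂ → t₁ ∈ T → t₂ ∈ T → t₁ ≡ t₂
    one-terminal t₁ t₂ p₁ p₂ t₁∈T t₂∈T = separated t₁∈T t₂∈T (~-trans (~-sym (inComponent p₁)) (inComponent p₂))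

  anchor∉S : ∀ {t w} → w ∉ S → Anchor t w → w ∈ B × t ~ w
  anchor∉S w∉S (deleted t∈S refl) = ⊥-elim (w∉S t∈S)
  anchor∉S w∉S (boundary w∈B t~w) = w∈B , t~w
  anchor∉S w∉S (neighbour w∈S _ _) = ⊥-elim (w∉S w∈S)

  anchor-path : ∀ {t w} → w ∈ S → Anchor t w →
    Σ (Path G w t) λ P → All (λ x → x ≡ w ⊎ x ~ t) (verts (proj₁ P))
  anchor-path w∈S (deleted _ refl) = (here , [] ∷ []) , inj₁ refl ∷ []
  anchor-path w∈S (boundary _ t~w) = ⊥-elim (~-target∉ t~w w∈S)
  anchor-path w∈S (neighbour _ e (p , p∉S)) with toPath p
  ... | (q , q-unique) , q⊆p = (step e q , All.map w≢ q∉S ∷ q-unique)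
                             , inj₁ refl ∷ All.tabulate (λ x∈q → inj₂ (~-suffix q q∉S x∈q))
    where
    q∉S = anti-mono q⊆p p∉S
    w≢ : ∀ {x} → x ∉ S → _ ≢ x
    w≢ x∉S w≡x = x∉S (subst (_∈ S) w≡x w∈S)

  -- Distinct terminals lie in distinct components of G - S, so these paths meet only at w.
  anchored-flower : ∀ {k w} → w ∈ S → (e : Fin k → Fin n) →
    (∀ i → e i ∈ T × Anchor (e i) w) → (∀ i j → e i ≡ e j → i ≡ j) → Flower G T w k
  anchored-flower {w = w} w∈S e anchored e-inj =
    e , (λ i → proj₁ (path i)) , (λ i → proj₁ (anchored i)) , e-inj , meet-at-w
    where
    path = λ i → anchor-path w∈S (proj₂ (anchored i))
    meet-at-w : ∀ i j → i ≢ j → ∀ x → x ∈ˡ verts (proj₁ (proj₁ (path i))) →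
                x ∈ˡ verts (proj₁ (proj₁ (path j))) → x ≡ w
    meet-at-w i j i≢j x x∈i x∈j with All.lookup (proj₂ (path i)) x∈i | All.lookup (proj₂ (path j)) x∈j
    ... | inj₁ x≡w | _ = x≡w
    ... | inj₂ _ | inj₁ x≡w = x≡w
    ... | inj₂ x~eᵢ | inj₂ x~eⱼ = ⊥-elim (i≢j (e-inj i j
          (separated (proj₁ (anchored i)) (proj₁ (anchored j)) (~-trans (~-sym x~eᵢ) x~eⱼ))))

  module Fibres (anchor : Fin n → Fin n) (anchored : ∀ t → Anchor t (anchor t)) where

    inFibre? : ∀ w → Decidable (λ t → t ∈ T × anchor t ≡ w)
    inFibre? w t = t ∈? T ×-dec (anchor t ≟ w)

    fibre : Fin n → ℕ
    fibre w = count (inFibre? w)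

    anchor-of : ∀ {w t} → t ∈ T × anchor t ≡ w → t ∈ T × Anchor t w
    anchor-of {t = t} (t∈T , refl) = t∈T , anchored t

    fibre∈S : ∀ {k w} → w ∈ S → ¬ Flower G T w (suc k) → fibre w ≤ k
    fibre∈S {k} {w} w∈S noFlower = count≤-if-no-injection (inFibre? w) k λ e inFibre e-inj →
      noFlower (anchored-flower w∈S e (λ i → anchor-of (inFibre i)) e-inj)

    fibre∉S : ∀ {w} → w ∉ S → fibre w ≤ indicator (w ∈? B)
    fibre∉S {w} w∉S with w ∈? B
    ... | yes _ = count≤-if-no-injection (inFibre? w) 1 λ e inFibre e-inj →
      let t~w = λ i → proj₂ (anchor∉S w∉S (proj₂ (anchor-of (inFibre i)))) in
      0≢1+n (e-inj zero (suc zero) (separated (proj₁ (inFibre zero)) (proj₁ (inFibre (suc zero)))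
        (~-trans (t~w zero) (~-sym (t~w (suc zero))))))
    ... | no w∉B = count≤-if-no-injection (inFibre? w) 0 λ e inFibre _ →
      w∉B (proj₁ (anchor∉S w∉S (proj₂ (anchor-of (inFibre zero)))))

    ∑-fibres-bound : ∀ {k} → ¬ (Σ (Fin n) λ w → Flower G T w (suc k)) → ∣ T ∣ ≤ k * ∣ S ∣ + ∣ B ∣
    ∑-fibres-bound {k} noFlower = begin
      ∣ T ∣                                       ≡⟨ ∣p∣≡count T ⟩
      count (_∈? T)                               ≤⟨ count≤∑-fibres (_∈? T) anchor ⟩
      ∑[ w < n ] fibre w                          ≤⟨ ∑-mono-≤ fibre≤ ⟩
      ∑[ w < n ] (k * 𝟙S w + 𝟙B w)                ≡⟨ ∑-distrib-+ (λ w → k * 𝟙S w) 𝟙B ⟩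
      ∑[ w < n ] (k * 𝟙S w) + count (_∈? B)       ≡⟨ cong₂ _+_ (≡.sym (*-distribˡ-sum k 𝟙S)) (≡.sym (∣p∣≡count B)) ⟩
      k * count (_∈? S) + ∣ B ∣                   ≡⟨ cong (λ s → k * s + ∣ B ∣) (≡.sym (∣p∣≡count S)) ⟩
      k * ∣ S ∣ + ∣ B ∣                           ∎
      where
      open ≤-Reasoning
      𝟙S 𝟙B : Fin n → ℕ
      𝟙S w = indicator (w ∈? S)
      𝟙B w = indicator (w ∈? B)
      fibre≤ : ∀ w → fibre w ≤ k * 𝟙S w + 𝟙B w
      fibre≤ w with w ∈? S
      ... | yes w∈S = ≤-trans (fibre∈S w∈S (λ flower → noFlower (w , flower)))
                        (≤-trans (≤-reflexive (≡.sym (*-identityʳ k))) (m≤m+n _ _))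
      ... | no w∉S = ≤-trans (fibre∉S w∉S) (m≤n+m _ (k * 0))

  -- Anchors exist only up to double negation, as connectivity is not decided;
  -- this suffices because the bound itself is decidable.
  terminal-bound : ¬ BadComponent G B T → ∀ {k} →
    ¬ (Σ (Fin n) λ w → Flower G T w (suc k)) → ∣ T ∣ ≤ k * ∣ S ∣ + ∣ B ∣
  terminal-bound noBad noFlower = decidable-stable (_ ≤? _) λ ¬bound →
    ¬¬-Π-Fin (anchor-exists noBad) λ anchors →
    ¬bound (Fibres.∑-fibres-bound (λ t → proj₁ (anchors t)) (λ t → proj₂ (anchors t)) noFlower)

quadratic-bound : ∀ b l → (l + b + 1) * l + b ≤ 2 * (b + l) ^ 2
quadratic-bound b l = begin
  (l + b + 1) * l + b          ≡⟨ solve 2 (λ b l → (l :+ b :+ con 1) :* l :+ b := (b :+ l) :* l :+ (b :+ l)) refl b l ⟩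
  (b + l) * l + (b + l)        ≤⟨ +-mono-≤ (*-monoʳ-≤ (b + l) (m≤n+m l b)) (n≤n*n (b + l)) ⟩
  (b + l) * (b + l) + (b + l) * (b + l) ≡⟨ solve 2 (λ b l → (b :+ l) :* (b :+ l) :+ (b :+ l) :* (b :+ l) := con 2 :* (b :+ l) :^ 2) refl b l ⟩
  2 * (b + l) ^ 2              ∎
  where
  open ≤-Reasoning
  open +-*-Solver
  n≤n*n : ∀ m → m ≤ m * m
  n≤n*n zero = z≤n
  n≤n*n m@(suc _) = m≤m*n m m

lemma18 : Σ ℕ λ c →
    ∀ (n : ℕ) (G : Graph n) (B T : Subset n) (ℓ : ℕ) →
    (Σ (Subset n) λ S → DTMCSolution G T S × ∣ S ∣ ≤ ℓ) →
    ¬ BadComponent G B T →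
    ¬ (Σ (Fin n) λ v → Flower G T v (ℓ + ∣ B ∣ + 2)) →
    ∣ T ∣ ≤ c * (∣ B ∣ + ℓ) ^ 2
lemma18 = 2 , λ n G B T ℓ (S , sol , ∣S∣≤ℓ) noBad noFlower → begin
  ∣ T ∣                              ≤⟨ terminal-bound sol noBad (noFlower ∘ flowerSize) ⟩
  (ℓ + ∣ B ∣ + 1) * ∣ S ∣ + ∣ B ∣    ≤⟨ +-monoˡ-≤ ∣ B ∣ (*-monoʳ-≤ (ℓ + ∣ B ∣ + 1) ∣S∣≤ℓ) ⟩
  (ℓ + ∣ B ∣ + 1) * ℓ + ∣ B ∣        ≤⟨ quadratic-bound ∣ B ∣ ℓ ⟩
  2 * (∣ B ∣ + ℓ) ^ 2                ∎
  where
  open ≤-Reasoning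
  flowerSize : ∀ {n} {G : Graph n} {T k} →
    Σ (Fin n) (λ w → Flower G T w (suc (k + 1))) → Σ (Fin n) (λ w → Flower G T w (k + 2))
  flowerSize {n} {G} {T} {k} = subst (λ m → Σ (Fin n) λ w → Flower G T w m) (≡.sym (+-suc k 1))
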